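{- Let $\mathbf{C},\mathbf{B},\mathbf{B}'$ be binary relations whose underlying sets are pairwise disjoint, each satisfying $1<\delta(\cdot)<\infty$ and $1<\delta(\cdot^\perp)<\infty$, and suppose there is a Tukey morphism $\mathbf{C}\to\mathbf{B}\oplus\mathbf{B}'$. Then there exist induced subrelations $\mathbf{A}=(A_-,A_+,A)$ and $\mathbf{A}'=(A'_-,A'_+,A')$ of $\mathbf{C}$ such that $C_-=A_-\sqcup A'_-$, $C_+=A_+\sqcup A'_+$, and there are Tukey morphisms $\mathbf{A}\to\mathbf{B}$ and $\mathbf{A}'\to\mathbf{B}'$.
   Context: A binary relation is a triple $\mathbf{A}=(A_-,A_+,A)$ where $A_-,A_+$ are sets and $A\subseteq A_-\times A_+$. An induced subrelation of $\mathbf{C}$ is $(S,T,C\cap(S\times T))$ with $S\subseteq C_-$, $T\subseteq C_+$. A (Tukey) morphism from $\mathbf{A}$ to $\mathbf{B}$ is a pair of functions $\phi_-\colon B_-\to A_-$, $\phi_+\colon A_+\to B_+$ such that for all $b\in B_-$ and $a\in A_+$, $\phi_-(b)\mathrel{A}a$ implies $b\mathrel{B}\phi_+(a)$. The disjoint union is $\mathbf{B}\oplus\mathbf{B}'=(B_-\sqcup B'_-,B_+\sqcup B'_+,B\oplus B')$ with $c\mathrel{(B\oplus B')}d$ iff $c\mathrel{B}d$ or $c\mathrel{B'}d$. A subset $Y\subseteq A_+$ is $\mathbf{A}$-dominating if every $a\in A_-$ has some $\alpha\in Y$ with $a\mathrel{A}\alpha$; $\delta(\mathbf{A})$ is the minimum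 cardinality of an $\mathbf{A}$-dominating family ($\infty$ if none). The dual is $\mathbf{A}^\perp=(A_+,A_-,R)$ with $x\mathrel{R}y$ iff not $y\mathrel{A}x$. -}

module Defs where

open import Level using (0ℓ)
open import Data.Product using (Σ; ∃; _×_; _,_; proj₁; proj₂)
open import Data.Sum using (_⊎_; inj₁; inj₂)
open import Relation.Binary.PropositionalEquality using (_≡_)
open import Relation.Nullary using (¬_)

record BinRel : Set₁ where
  constructor binRel
  field
    Neg : Set
    Pos : Set
    Rel : Neg → Pos → Set
open BinRel public

record Tukey (A B : BinRel) : Set where
  constructor tukey
  field
    φ₋ : Neg B → Neg A
    φ₊ : Pos A → Pos B
    preserves : ∀ (b : Neg B) (a : Pos A) →
      Rel A (φ₋ b) a → Rel B b (φ₊ a)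
open Tukey public

data SumRel (B B' : BinRel) : Neg B ⊎ Neg B' → Pos B ⊎ Pos B' → Set where
  left  : ∀ {c d} → Rel B c d  → SumRel B B' (inj₁ c) (inj₁ d)
  right : ∀ {c d} → Rel B' c d → SumRel B B' (inj₂ c) (inj₂ d)

_⊕_ : BinRel → BinRel → BinRel
B ⊕ B' = binRel (Neg B ⊎ Neg B') (Pos B ⊎ Pos B') (SumRel B B')

_^⊥ : BinRel → BinRel
A ^⊥ = binRel (Pos A) (Neg A) (λ x y → ¬ Rel A y x)

Induced : (C : BinRel) → (Neg C → Set) → (Pos C → Set) → BinRel
Induced C S T =
  binRel (Σ (Neg C) S) (Σ (Pos C) T) (λ x y → Rel C (proj₁ x) (proj₁ y))

Dominating : (A : BinRel) → (Pos A → Set) → Set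
Dominating A Y = ∀ (a : Neg A) → ∃ λ α → Y α × Rel A a α

AtMostOne : {X : Set} → (X → Set) → Set
AtMostOne {X} Y = ∀ (x y : X) → Y x → Y y → x ≡ y

δ<∞ : BinRel → Set₁
δ<∞ A = ∃ λ (Y : Pos A → Set) → Dominating A Y

1<δ : BinRel → Set₁
1<δ A = ¬ (∃ λ (Y : Pos A → Set) → AtMostOne Y × Dominating A Y)

Nice : BinRel → Set₁
Nice A = (1<δ A × δ<∞ A) × (1<δ (A ^⊥) × δ<∞ (A ^⊥))

Partition : {X : Set} → (X → Set) → (X → Set) → Set
Partition {X} S S' = (∀ x → S x ⊎ S' x) × (∀ x → ¬ (S x × S' x))

-- A morphism (φ₋ , φ₊) : C → B ⊕ B' splits C₊ by the summand into which φ₊ sends each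
-- point, and the image of B₋ under φ₋ is put on the B side of C₋. That image is
-- disjoint from the image of B'₋: a point of C₋ is C-related to some α (as δ(C) < ∞),
-- and φ₊ α would then be ⊕-related to points of both summands. The rest of C₋ goes to
-- the B' side; it is only here that excluded middle is needed.
module Submission where

open import Defs
open import Level using (0ℓ)
open import Function using (_∘_)
open import Data.Product using (∃; _×_; _,_; proj₁; proj₂)
open import Data.Sum using (_⊎_; inj₁; inj₂)
open import Data.Empty using (⊥)
open import Relation.Nullary using (¬_)
open import Relation.Nullary.Decidable using (toSum)
open import Relation.Binary.PropositionalEquality using (_≡_; _≢_; refl; subst)
open import Axiom.ExcludedMiddle using (ExcludedMiddle)

module _ {B B' : BinRel} where

  SumRel-inj₁⁻¹ : ∀ {b d y} → SumRel B B' (inj₁ b) d → d ≡ inj₁ y → Rel B b y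
  SumRel-inj₁⁻¹ (left r) refl = r

  SumRel-inj₂⁻¹ : ∀ {b' d y} → SumRel B B' (inj₂ b') d → d ≡ inj₂ y → Rel B' b' y
  SumRel-inj₂⁻¹ (right r) refl = r

  SumRel-summands-disjoint : ∀ {b b' d} →
    SumRel B B' (inj₁ b) d → SumRel B B' (inj₂ b') d → ⊥
  SumRel-summands-disjoint (left _) ()

module _ {X Y Z : Set} where

  FromInj₁ : (X → Y ⊎ Z) → X → Set
  FromInj₁ f x = ∃ λ y → f x ≡ inj₁ y

  FromInj₂ : (X → Y ⊎ Z) → X → Set
  FromInj₂ f x = ∃ λ z → f x ≡ inj₂ z

  fibres-partition : (f : X → Y ⊎ Z) → Partition (FromInj₁ f) (FromInj₂ f)
  fibres-partition f = covers , disjoint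
    where
    covers : ∀ x → FromInj₁ f x ⊎ FromInj₂ f x
    covers x with f x
    ... | inj₁ y = inj₁ (y , refl)
    ... | inj₂ z = inj₂ (z , refl)

    disjoint : ∀ x → ¬ (FromInj₁ f x × FromInj₂ f x)
    disjoint x ((y , fx≡y) , (z , fx≡z)) with f x
    disjoint x ((y , refl) , (z , ())) | _

complement-partition : ExcludedMiddle 0ℓ → {X : Set} (S : X → Set) → Partition S (¬_ ∘ S)
complement-partition lem S = (λ x → toSum lem) , (λ x (s , ¬s) → ¬s s)

module _ {C B B' : BinRel} (t : Tukey C (B ⊕ B')) where

  restrict₁ : (S : Neg C → Set) → (∀ b → S (φ₋ t (inj₁ b))) →
    Tukey (Induced C S (FromInj₁ (φ₊ t))) B
  restrict₁ S φ₋b∈S = tukey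
    (λ b → φ₋ t (inj₁ b) , φ₋b∈S b)
    (λ (_ , y , _) → y)
    (λ b (a , _ , φ₊a≡y) r → SumRel-inj₁⁻¹ (preserves t (inj₁ b) a r) φ₊a≡y)

  restrict₂ : (S : Neg C → Set) → (∀ b' → S (φ₋ t (inj₂ b'))) →
    Tukey (Induced C S (FromInj₂ (φ₊ t))) B'
  restrict₂ S φ₋b'∈S = tukey
    (λ b' → φ₋ t (inj₂ b') , φ₋b'∈S b')
    (λ (_ , y , _) → y)
    (λ b' (a , _ , φ₊a≡y) r → SumRel-inj₂⁻¹ (preserves t (inj₂ b') a r) φ₊a≡y)

  φ₋-separates-summands : δ<∞ C → ∀ b b' → φ₋ t (inj₁ b) ≢ φ₋ t (inj₂ b')
  φ₋-separates-summands (_ , dominating) b b' φ₋b≡φ₋b' =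
    SumRel-summands-disjoint
      (preserves t (inj₁ b) α r)
      (preserves t (inj₂ b') α (subst (λ c → Rel C c α) φ₋b≡φ₋b' r))
    where
    α = proj₁ (dominating (φ₋ t (inj₁ b)))
    r = proj₂ (proj₂ (dominating (φ₋ t (inj₁ b))))

lemma3p5 : ExcludedMiddle 0ℓ →
    (C B B' : BinRel) → Nice C → Nice B → Nice B' →
    Tukey C (B ⊕ B') →
    ∃ λ (S₋ : Neg C → Set) → ∃ λ (S₊ : Pos C → Set) →
    ∃ λ (S'₋ : Neg C → Set) → ∃ λ (S'₊ : Pos C → Set) →
    Partition S₋ S'₋ × Partition S₊ S'₊ ×
    Tukey (Induced C S₋ S₊) B × Tukey (Induced C S'₋ S'₊) B'
lemma3p5 lem C B B' ((_ , δC<∞) , _) _ _ t =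
  Image₁ , FromInj₁ (φ₊ t) , ¬_ ∘ Image₁ , FromInj₂ (φ₊ t) ,
  complement-partition lem Image₁ ,
  fibres-partition (φ₊ t) ,
  restrict₁ t Image₁ (λ b → b , refl) ,
  restrict₂ t (¬_ ∘ Image₁) (λ b' (b , e) → φ₋-separates-summands t δC<∞ b b' e)
  where
  Image₁ : Neg C → Set
  Image₁ c = ∃ λ b → φ₋ t (inj₁ b) ≡ c
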